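{- Let $k\ge 2$ divide $q-1$. If $\theta$ is a near-linear orthomorphism of index $k$ over $\mathbb{F}_q$, then $\theta\in\mathscr{D}_k(q)$.
   Context: Let $\mathbb{F}_q$ be the finite field of order $q$. An orthomorphism over $\mathbb{F}_q$ is a permutation $\theta$ of $\mathbb{F}_q$ such that $x\mapsto\theta(x)-x$ is also a permutation. For $k\mid(q-1)$, fix a generator $g$ of $\mathbb{F}_q^*$ and let $C_{k,i}=\{g^j: j\equiv i\pmod k\}$, $0\le i<k$ (cyclotomy classes of index $k$). A cyclotomic map of index $k$ with multipliers $[a_0,\dots,a_{k-1}]$ is $\theta(0)=0$, $\theta(x)=a_ix$ for $x\in C_{k,i}$. A cyclotomic orthomorphism of index $k$ is an orthomorphism which is such a map; $\mathscr{C}_k(q)$ is the set of them, and $\mathscr{D}_k(q)=\mathscr{C}_k(q)\setminus\bigcup_{\ell<k,\ \ell\mid(q-1)}\mathscr{C}_\ell(q)$ (orthomorphisms of least index $k$). A cyclotomic orthomorphism of index $k$ with multipliers $[a_0,\dots,a_{k-1}]$ is near-linear if $a_0\neq a_1=a_2=\cdots=a_{k-1}$. -}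

module Defs where

open import Level using (0ℓ)
open import Data.Nat using (ℕ; zero; suc; _<_; _≤_; _∸_; NonZero)
open import Data.Nat.DivMod using (_mod_)
open import Data.Fin using (Fin)
open import Data.Product using (Σ; ∃; _×_; _,_)
open import Relation.Binary.PropositionalEquality using (_≡_)
open import Relation.Nullary using (¬_)
open import Algebra.Bundles using (CommutativeRing)
open import Function.Bundles using (_↔_)
open import Function.Definitions using (Bijective)

record FiniteField (q : ℕ) : Set₁ where
  field
    cring : CommutativeRing 0ℓ 0ℓ
  open CommutativeRing cring public
  field
    ≈-is-≡  : ∀ {x y} → x ≈ y → x ≡ y
    0≢1     : ¬ (0# ≡ 1#)
    inverse : ∀ x → ¬ (x ≡ 0#) → ∃ λ y → x * y ≡ 1#
    enum    : Carrier ↔ Fin q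

module _ {q : ℕ} (F : FiniteField q) where
  open FiniteField F

  pow : Carrier → ℕ → Carrier
  pow x zero    = 1#
  pow x (suc n) = x * pow x n

  IsGenerator : Carrier → Set
  IsGenerator g = ∀ x → ¬ (x ≡ 0#) → ∃ λ j → x ≡ pow g j

  IsPermutation : (Carrier → Carrier) → Set
  IsPermutation f = Bijective _≡_ _≡_ f

  IsOrthomorphism : (Carrier → Carrier) → Set
  IsOrthomorphism θ = IsPermutation θ × IsPermutation (λ x → θ x - x)

  -- θ is the cyclotomic map of index k (w.r.t. generator g) with multipliers a:
  -- θ(0) = 0 and θ(x) = a_i x for x ∈ C_{k,i} = { g^j : j ≡ i mod k }.
  IsCyclotomicMap : (g : Carrier) (k : ℕ) .{{_ : NonZero k}} →
                    (Fin k → Carrier) → (Carrier → Carrier) → Set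
  IsCyclotomicMap g k a θ =
    (θ 0# ≡ 0#) × (∀ j → θ (pow g j) ≡ a (j mod k) * pow g j)

  InC : (g : Carrier) (k : ℕ) .{{_ : NonZero k}} → (Carrier → Carrier) → Set
  InC g k θ = IsOrthomorphism θ × ∃ λ (a : Fin k → Carrier) → IsCyclotomicMap g k a θ

  InD : (g : Carrier) (k : ℕ) .{{_ : NonZero k}} → (Carrier → Carrier) → Set
  InD g k θ = InC g k θ ×
    (∀ (ℓ : ℕ) .{{_ : NonZero ℓ}} → ℓ < k → ℓ ∣ (q ∸ 1) → ¬ InC g ℓ θ)
    where open import Data.Nat.Divisibility using (_∣_)

  NearLinear : (k : ℕ) → (Fin k → Carrier) → Set
  NearLinear zero a = Data.Empty.⊥ where import Data.Empty
  NearLinear (suc zero) a = Data.Empty.⊥ where import Data.Empty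
  NearLinear (suc (suc m)) a =
    ¬ (a Fin.zero ≡ a (Fin.suc Fin.zero)) × (∀ (i : Fin (suc m)) → a (Fin.suc i) ≡ a (Fin.suc Fin.zero))
    where import Data.Fin as Fin

{-# OPTIONS --safe #-}
-- If θ were also cyclotomic of a smaller index ℓ with multipliers b,
-- then comparing θ(g^j) for both descriptions and cancelling g^j ≠ 0 gives
-- b_{j mod ℓ} = a_{j mod k} for all j.  At j = 0 this reads b_0 = a_0, and at
-- j = ℓ (where 0 < ℓ < k) it reads b_0 = a_ℓ = a_1, contradicting a_0 ≠ a_1.
-- The only subtlety is g ≠ 0, which holds because k ∣ q - 1 with k ≥ 2 forces q > 2.
module Submission where

open import Defs
open import Data.Nat using (ℕ; zero; suc; _≤_; _<_; _∸_; _%_; NonZero; s≤s)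
open import Data.Nat.Properties using (≤-trans; <⇒≱)
open import Data.Nat.Divisibility using (_∣_; ∣⇒≤)
open import Data.Nat.DivMod using (_mod_; n%n≡0; m<n⇒m%n≡m)
open import Data.Fin using (Fin; zero; suc; toℕ; _≟_)
open import Data.Fin.Properties using (toℕ-fromℕ<; toℕ-injective; injective⇒≤; 0≢1+n)
open import Data.Product using (∃; _×_; _,_)
open import Data.Sum using (_⊎_; inj₁; inj₂; [_,_])
open import Data.Empty using (⊥-elim)
open import Function using (_∘_; const)
open import Function.Bundles using (Injection; Inverse)
open import Function.Properties.Inverse using (↔⇒↣; ↔-sym)
open import Relation.Nullary using (¬_; yes; no)
open import Relation.Nullary.Decidable using (via-injection)
open import Relation.Binary.Definitions using (DecidableEquality)
open import Relation.Binary.PropositionalEquality using (_≡_; refl; sym; trans; cong; module ≡-Reasoning)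

toℕ-mod : ∀ m n .{{_ : NonZero n}} → toℕ (m mod n) ≡ m % n
toℕ-mod m (suc n) = toℕ-fromℕ< _

2≤k∣q∸1⇒2<q : ∀ {k q} → 2 ≤ k → k ∣ q ∸ 1 → 2 ≤ q → 2 < q
2≤k∣q∸1⇒2<q {q = 1} _ _ (s≤s ())
2≤k∣q∸1⇒2<q {q = suc (suc _)} 2≤k k∣q-1 _ = s≤s (≤-trans 2≤k (∣⇒≤ k∣q-1))

module _ {q : ℕ} (F : FiniteField q) where
  open FiniteField F using (Carrier; 0#; 1#; _*_; *-assoc; *-identityʳ; zeroˡ; ≈-is-≡; 0≢1; inverse; enum)
  open Inverse enum using (to; from)
  open ≡-Reasoning

  private
    toFin-injective : ∀ {x y} → to x ≡ to y → x ≡ y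
    toFin-injective = Injection.injective (↔⇒↣ enum)

    fromFin-injective : ∀ {i j} → from i ≡ from j → i ≡ j
    fromFin-injective = Injection.injective (↔⇒↣ (↔-sym enum))

  _≟F_ : DecidableEquality Carrier
  _≟F_ = via-injection (↔⇒↣ enum) _≟_

  *-cancelʳ-≢0 : ∀ c x y → ¬ c ≡ 0# → x * c ≡ y * c → x ≡ y
  *-cancelʳ-≢0 c x y c≢0 xc≡yc with inverse c c≢0
  ... | c⁻¹ , cc⁻¹≡1 = begin
    x               ≡⟨ ≈-is-≡ (*-identityʳ x) ⟨
    x * 1#          ≡⟨ cong (x *_) cc⁻¹≡1 ⟨
    x * (c * c⁻¹)   ≡⟨ ≈-is-≡ (*-assoc x c c⁻¹) ⟨
    (x * c) * c⁻¹   ≡⟨ cong (_* c⁻¹) xc≡yc ⟩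
    (y * c) * c⁻¹   ≡⟨ ≈-is-≡ (*-assoc y c c⁻¹) ⟩
    y * (c * c⁻¹)   ≡⟨ cong (y *_) cc⁻¹≡1 ⟩
    y * 1#          ≡⟨ ≈-is-≡ (*-identityʳ y) ⟩
    y               ∎

  x*y≢0 : ∀ {x y} → ¬ x ≡ 0# → ¬ y ≡ 0# → ¬ x * y ≡ 0#
  x*y≢0 {x} {y} x≢0 y≢0 xy≡0 =
    x≢0 (*-cancelʳ-≢0 y x 0# y≢0 (trans xy≡0 (sym (≈-is-≡ (zeroˡ y)))))

  pow-≢0 : ∀ {x} n → ¬ x ≡ 0# → ¬ pow F x n ≡ 0#
  pow-≢0 zero    x≢0 1≡0 = 0≢1 (sym 1≡0)
  pow-≢0 (suc n) x≢0     = x*y≢0 x≢0 (pow-≢0 n x≢0)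

  2≤q : 2 ≤ q
  2≤q = injective⇒≤ {f = to ∘ bit} (bit-injective ∘ toFin-injective)
    where
    bit : Fin 2 → Carrier
    bit zero    = 0#
    bit (suc _) = 1#

    bit-injective : ∀ {i j} → bit i ≡ bit j → i ≡ j
    bit-injective {zero}     {zero}     _   = refl
    bit-injective {zero}     {suc zero} 0≡1 = ⊥-elim (0≢1 0≡1)
    bit-injective {suc zero} {zero}     1≡0 = ⊥-elim (0≢1 (sym 1≡0))
    bit-injective {suc zero} {suc zero} _   = refl

  ⊆01⇒q≤2 : (∀ x → x ≡ 0# ⊎ x ≡ 1#) → q ≤ 2
  ⊆01⇒q≤2 ⊆01 = injective⇒≤ {f = bit ∘ from} (fromFin-injective ∘ bit-injective)
    where
    bit : Carrier → Fin 2
    bit x = [ const zero , const (suc zero) ] (⊆01 x)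

    bit-injective : ∀ {x y} → bit x ≡ bit y → x ≡ y
    bit-injective {x} {y} e with ⊆01 x | ⊆01 y
    ... | inj₁ x≡0 | inj₁ y≡0 = trans x≡0 (sym y≡0)
    ... | inj₂ x≡1 | inj₂ y≡1 = trans x≡1 (sym y≡1)
    ... | inj₁ _   | inj₂ _   = ⊥-elim (0≢1+n e)
    ... | inj₂ _   | inj₁ _   = ⊥-elim (0≢1+n (sym e))

  zero-generator⇒⊆01 : ∀ {g} → IsGenerator F g → g ≡ 0# → ∀ x → x ≡ 0# ⊎ x ≡ 1#
  zero-generator⇒⊆01 {g} gen g≡0 x with x ≟F 0#
  ... | yes x≡0 = inj₁ x≡0
  ... | no x≢0 with gen x x≢0
  ... | zero  , x≡1     = inj₂ x≡1
  ... | suc j , x≡g·gʲ  = ⊥-elim (x≢0 (begin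
    x                ≡⟨ x≡g·gʲ ⟩
    g * pow F g j    ≡⟨ cong (_* pow F g j) g≡0 ⟩
    0# * pow F g j   ≡⟨ ≈-is-≡ (zeroˡ _) ⟩
    0#               ∎))

  generator-≢0 : ∀ {g} → IsGenerator F g → 2 < q → ¬ g ≡ 0#
  generator-≢0 gen 2<q g≡0 = <⇒≱ 2<q (⊆01⇒q≤2 (zero-generator⇒⊆01 gen g≡0))

  cyclotomic-multipliers-agree :
    ∀ {g θ} (k ℓ : ℕ) .{{_ : NonZero k}} .{{_ : NonZero ℓ}} {a : Fin k → Carrier} {b : Fin ℓ → Carrier} →
    ¬ g ≡ 0# → IsCyclotomicMap F g k a θ → IsCyclotomicMap F g ℓ b θ →
    ∀ j → b (j mod ℓ) ≡ a (j mod k)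
  cyclotomic-multipliers-agree {g} k ℓ g≢0 (_ , θ-a) (_ , θ-b) j =
    *-cancelʳ-≢0 (pow F g j) _ _ (pow-≢0 j g≢0) (trans (sym (θ-b j)) (θ-a j))

  near-linear-separates : ∀ k (a : Fin k → Carrier) → NearLinear F k a →
    ∀ {i j} → toℕ i ≡ 0 → ¬ toℕ j ≡ 0 → ¬ a i ≡ a j
  near-linear-separates (suc (suc _)) a _                 {zero} {zero}  _ j≢0   = ⊥-elim (j≢0 refl)
  near-linear-separates (suc (suc _)) a (a₀≢a₁ , a-const) {zero} {suc j} _ _   a₀≡aⱼ =
    a₀≢a₁ (trans a₀≡aⱼ (a-const j))

  near-linear-not-smaller-index :
    ∀ {g θ} (k ℓ : ℕ) .{{_ : NonZero k}} .{{_ : NonZero ℓ}} {a : Fin k → Carrier} →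
    ¬ g ≡ 0# → NearLinear F k a → IsCyclotomicMap F g k a θ → ℓ < k →
    ∀ (b : Fin ℓ → Carrier) → ¬ IsCyclotomicMap F g ℓ b θ
  near-linear-not-smaller-index {θ = θ} k@(suc _) ℓ@(suc _) {a} g≢0 near-linear θ-a ℓ<k b θ-b =
    near-linear-separates k a near-linear (toℕ-mod 0 k) ℓ-mod-k≢0 (begin
      a (0 mod k)   ≡⟨ agree 0 ⟨
      b (0 mod ℓ)   ≡⟨ cong b (toℕ-injective (trans (toℕ-mod 0 ℓ) (sym ℓ-mod-ℓ≡0))) ⟩
      b (ℓ mod ℓ)   ≡⟨ agree ℓ ⟩
      a (ℓ mod k)   ∎)
    where
    agree : ∀ j → b (j mod ℓ) ≡ a (j mod k)
    agree = cyclotomic-multipliers-agree {θ = θ} k ℓ {a} {b} g≢0 θ-a θ-b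
    ℓ-mod-ℓ≡0 : toℕ (ℓ mod ℓ) ≡ 0
    ℓ-mod-ℓ≡0 = trans (toℕ-mod ℓ ℓ) (n%n≡0 ℓ)
    ℓ-mod-k≢0 : ¬ toℕ (ℓ mod k) ≡ 0
    ℓ-mod-k≢0 e with () ← trans (sym (m<n⇒m%n≡m ℓ<k)) (trans (sym (toℕ-mod ℓ k)) e)

lemma2p3 : ∀ {q : ℕ} (F : FiniteField q) (g : FiniteField.Carrier F) →
    IsGenerator F g →
    ∀ (k : ℕ) .{{_ : NonZero k}} → 2 ≤ k → k ∣ (q ∸ 1) →
    ∀ (θ : FiniteField.Carrier F → FiniteField.Carrier F) →
    (∃ λ (a : Fin k → FiniteField.Carrier F) →
       NearLinear F k a × IsCyclotomicMap F g k a θ) →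
    IsOrthomorphism F θ →
    InD F g k θ
lemma2p3 {q} F g gen k 2≤k k∣q-1 θ (a , near-linear , θ-a) orthomorphism =
  (orthomorphism , a , θ-a) , no-smaller-index
  where
  2<q : 2 < q
  2<q = 2≤k∣q∸1⇒2<q 2≤k k∣q-1 (2≤q F)
  no-smaller-index : ∀ (ℓ : ℕ) .{{_ : NonZero ℓ}} → ℓ < k → ℓ ∣ (q ∸ 1) → ¬ InC F g ℓ θ
  no-smaller-index ℓ ℓ<k _ (_ , b , θ-b) =
    near-linear-not-smaller-index F {θ = θ} k ℓ (generator-≢0 F gen 2<q) near-linear θ-a ℓ<k b θ-b
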